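{- Let $F$ be a finite field and $q=|F|$. Let $k,m,n\in\mathbb{N}$ satisfy $k\leq n+1$. Let $v=(v_0,v_1,\ldots,v_m)\in F^{1\times(m+1)}$ be a nonzero row vector with $v_m=0$, and let $R(v)=(v_0,v_1,\ldots,v_{m-1})\in F^{1\times m}$. Fix any $k$-tuple $a\in F^k$. Then \[\sum_{\substack{x\in F^{m+n+1};\\ x_{[0,k)}=a}}[\,v\,H_{m,n}(x)=0\,]=q\sum_{\substack{x\in F^{m+n+1};\\ x_{[0,k)}=a}}[\,R(v)\,H_{m-1,n+1}(x)=0\,].\]
   Context: $\mathbb{N}=\{0,1,2,\ldots\}$. For $x=(x_0,\ldots,x_{m+n})\in F^{m+n+1}$ and integers $p,t\geq -1$ with $p+t\leq m+n$, $H_{p,t}(x)$ is the $(p+1)\times(t+1)$ matrix $(x_{i+j})_{0\leq i\leq p,\ 0\leq j\leq t}$. For a tuple $x$, $x_{[0,k)}=(x_0,\ldots,x_{k-1})$. For a statement $\mathcal{A}$, $[\mathcal{A}]$ is $1$ if $\mathcal{A}$ is true and $0$ otherwise. -}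

module Defs where

open import Level using (Level)
open import Data.Nat as ℕ using (ℕ; zero; suc; _≤_; _<_; z≤n; s≤s)
open import Data.Nat.Properties using (+-suc; ≤-trans; +-mono-≤; ≤-reflexive; m≤n+m)
open import Data.Fin using (Fin; zero; suc; toℕ; fromℕ; fromℕ<; inject₁; inject≤)
open import Data.Fin.Properties using (toℕ<n; all?)
open import Data.Product using (∃; _,_)
open import Relation.Binary.PropositionalEquality using (_≡_; refl; sym; cong; trans)
open import Relation.Nullary using (¬_; Dec; yes; no)
open import Relation.Binary.Definitions using (DecidableEquality)
open import Algebra.Structures using (IsCommutativeRing)
open import Function.Bundles using (_↔_; Inverse)
open import Data.Vec.Functional using (_∷_)

-- Finite fields (agda-stdlib has no field bundle): a commutative ring
-- with propositional equality, 0 ≠ 1, multiplicative inverses of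
-- nonzero elements, and a bijection with Fin size (size = q = |F|).

record FiniteField (c : Level) : Set (Level.suc c) where
  infixl 7 _*_
  infixl 6 _+_
  field
    Carrier  : Set c
    _+_ _*_  : Carrier → Carrier → Carrier
    -_       : Carrier → Carrier
    0# 1#    : Carrier
    isCommutativeRing : IsCommutativeRing _≡_ _+_ _*_ -_ 0# 1#
    0≢1      : ¬ (0# ≡ 1#)
    inverse  : (x : Carrier) → ¬ (x ≡ 0#) → ∃ λ y → x * y ≡ 1#
    size     : ℕ
    enum     : Fin size ↔ Carrier
    -- decidable equality (derivable from finiteness; included for convenience)
    _≟_      : DecidableEquality Carrier

module _ {c : Level} (F : FiniteField c) where
  open FiniteField F

  sumF : (r : ℕ) → (Fin r → Carrier) → Carrier
  sumF zero    f = 0#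
  sumF (suc r) f = f zero + sumF r (λ i → f (suc i))

  sumOverF : (Carrier → ℕ) → ℕ
  sumOverF g = go size (Inverse.to enum)
    where
      go : (s : ℕ) → (Fin s → Carrier) → ℕ
      go zero    e = 0
      go (suc s) e = g (e zero) ℕ.+ go s (λ i → e (suc i))

  sumVec : (N : ℕ) → ((Fin N → Carrier) → ℕ) → ℕ
  sumVec zero    g = g (λ ())
  sumVec (suc N) g = sumOverF (λ a → sumVec N (λ x → g (a ∷ x)))

  iverson : {ℓ : Level} {A : Set ℓ} → Dec A → ℕ
  iverson (yes _) = 1
  iverson (no  _) = 0

  hankelIdx : ∀ {r c L} → r ℕ.+ c ≤ suc L → (i : Fin r) (j : Fin c) → toℕ i ℕ.+ toℕ j < L
  hankelIdx {r} {c} {L} h i j with +-mono-≤ (toℕ<n i) (toℕ<n j)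
  ... | p = pred2 (≤-trans (≤-reflexive (cong suc (sym (+-suc (toℕ i) (toℕ j))))) (≤-trans p h))
    where
      pred2 : ∀ {a b} → suc (suc a) ≤ suc b → suc a ≤ b
      pred2 (s≤s q) = q

  -- w · H(x), where w has r entries, H has r rows and c columns and
  -- H(x)_{ij} = x_{i+j}; x has L entries with (r-1)+(c-1) ≤ L-1.
  rowHankel : ∀ {L} (r c : ℕ) → r ℕ.+ c ≤ suc L →
              (Fin r → Carrier) → (Fin L → Carrier) → Fin c → Carrier
  rowHankel r c h w x j = sumF r (λ i → w i * x (fromℕ< (hankelIdx h i j)))

  isZero? : (c : ℕ) (y : Fin c → Carrier) → Dec (∀ j → y j ≡ 0#)
  isZero? c y = all? (λ j → y j ≟ 0#)

  bound₁ : (m n : ℕ) → suc m ℕ.+ suc n ≤ suc (suc (m ℕ.+ n))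
  bound₁ m n = ≤-reflexive (cong suc (+-suc m n))

  bound₂ : (m n : ℕ) → m ℕ.+ suc (suc n) ≤ suc (suc (m ℕ.+ n))
  bound₂ m n = ≤-reflexive (trans (+-suc m (suc n)) (cong suc (+-suc m n)))

  prefixBound : (k m n : ℕ) → k ≤ suc n → k ≤ suc (m ℕ.+ n)
  prefixBound k m n h = ≤-trans h (s≤s (m≤n+m n m))

  prefix? : (k N : ℕ) (p : k ≤ N) → (x : Fin N → Carrier) (a : Fin k → Carrier) →
            Dec (∀ i → x (inject≤ i p) ≡ a i)
  prefix? k N p x a = all? (λ i → x (inject≤ i p) ≟ a i)

{-# OPTIONS --safe #-}
module Submission where

-- Let d be the largest index with v_d ≠ 0 (so d < m, as v_m = 0) and p = d + n + 1.
-- The prefix x_[0,k) and every entry x_(i+j) that v H_{m,n}(x) reads with v_i ≠ 0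
-- have index below p, so the left summand does not depend on x_p: summing x_p out
-- gives the factor q. R(v) H_{m-1,n+1}(x) consists of the columns of v H_{m,n}(x)
-- plus one more column, equal to v_d x_p plus terms in x_(<p); since v_d ≠ 0 exactly
-- one value of x_p makes it vanish, so summing x_p out on the right gives the factor 1.

open import Defs
open import Level using (Level)
open import Data.Nat as ℕ using (ℕ; zero; suc; _+_; _*_; _≤_; z≤n; s≤s)
open import Data.Nat.Properties as ℕ using (+-*-semiring)
open import Data.Fin as Fin using (Fin; zero; suc; toℕ; fromℕ; fromℕ<; inject₁; punchIn; punchOut)
open import Data.Fin.Properties
  using (toℕ-injective; toℕ<n; toℕ-fromℕ; toℕ-fromℕ<; toℕ-inject≤; toℕ-inject₁; toℕ-lower₁;
         punchInᵢ≢i; punchIn-punchOut)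
open import Data.Vec.Functional using (Vector; _∷_; tail; insertAt; removeAt)
open import Data.Vec.Functional.Properties using (insertAt-lookup; insertAt-punchIn)
open import Data.Product using (∃; _×_; _,_; proj₁; proj₂)
open import Data.Sum using (_⊎_; inj₁; inj₂)
open import Algebra.Bundles using (CommutativeRing)
import Algebra.Properties.Semiring.Sum as SemiringSum
import Algebra.Properties.AbelianGroup as AbelianGroupProperties
open import Function using (_∘_; _⇔_; mk⇔; Inverse)
open import Function.Bundles using (module Equivalence)
open import Relation.Binary.PropositionalEquality
open import Relation.Nullary using (¬_; Dec; yes; no; contradiction)
open import Relation.Unary using (Pred; Decidable)

∀⊎∃¬-largest : ∀ {r p} {P : Pred (Fin r) p} → Decidable P →
               (∀ i → P i) ⊎ ∃ λ d → ¬ P d × (∀ i → ¬ P i → i Fin.≤ d)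
∀⊎∃¬-largest {zero} P? = inj₁ λ ()
∀⊎∃¬-largest {suc r} P? with ∀⊎∃¬-largest (P? ∘ suc)
... | inj₂ (d , ¬Pd , largest) = inj₂ (suc d , ¬Pd , λ { zero _ → z≤n ; (suc i) ¬Pi → s≤s (largest i ¬Pi) })
... | inj₁ ∀P with P? zero
...   | yes P0 = inj₁ λ { zero → P0 ; (suc i) → ∀P i }
...   | no ¬P0 = inj₂ (zero , ¬P0 , λ { zero _ → z≤n ; (suc i) ¬Pi → contradiction (∀P i) ¬Pi })

module _ {a} {A : Set a} where

  -- insertAt rebuilt from _∷_, so that sumVec unfolds along it definitionally.
  insert : ∀ {N} → Fin (suc N) → A → Vector A N → Vector A (suc N)
  insert zero          t y = t ∷ y
  insert {suc N} (suc p) t y = y zero ∷ insert p t (tail y)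

  insert≗insertAt : ∀ {N} (p : Fin (suc N)) t (y : Vector A N) → insert p t y ≗ insertAt y p t
  insert≗insertAt zero          t y zero    = refl
  insert≗insertAt zero          t y (suc j) = refl
  insert≗insertAt {suc N} (suc p) t y zero    = refl
  insert≗insertAt {suc N} (suc p) t y (suc j) = insert≗insertAt p t (tail y) j

  insert-lookup : ∀ {N} (p : Fin (suc N)) t (y : Vector A N) → insert p t y p ≡ t
  insert-lookup p t y = trans (insert≗insertAt p t y p) (insertAt-lookup y p t)

  insert-punchOut : ∀ {N} {p j : Fin (suc N)} t (y : Vector A N) (p≢j : p ≢ j) →
                    insert p t y j ≡ y (punchOut p≢j)
  insert-punchOut {p = p} {j} t y p≢j = begin
    insert p t y j                            ≡⟨ insert≗insertAt p t y j ⟩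
    insertAt y p t j                          ≡⟨ cong (insertAt y p t) (punchIn-punchOut p≢j) ⟨
    insertAt y p t (punchIn p (punchOut p≢j)) ≡⟨ insertAt-punchIn y p t (punchOut p≢j) ⟩
    y (punchOut p≢j)                          ∎
    where open ≡-Reasoning

  insert-≢ : ∀ {N} {p j : Fin (suc N)} t t' (y : Vector A N) → p ≢ j → insert p t y j ≡ insert p t' y j
  insert-≢ t t' y p≢j = trans (insert-punchOut t y p≢j) (sym (insert-punchOut t' y p≢j))

∀≡-cong : ∀ {a b} {I : Set a} {A : Set b} {f g : I → A} (h : I → A) →
          f ≗ g → (∀ i → f i ≡ h i) ⇔ (∀ i → g i ≡ h i)
∀≡-cong h f≗g = mk⇔ (λ f≡h i → trans (sym (f≗g i)) (f≡h i)) (λ g≡h i → trans (f≗g i) (g≡h i))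

module ℕΣ = SemiringSum +-*-semiring

sum-const : ∀ n k → ℕΣ.sum {n} (λ _ → k) ≡ n * k
sum-const zero    k = refl
sum-const (suc n) k = cong (k +_) (sum-const n k)

sum-single : ∀ {n} (f : Fin n → ℕ) (i₀ : Fin n) → (∀ i → i ≢ i₀ → f i ≡ 0) → ℕΣ.sum f ≡ f i₀
sum-single {suc n} f i₀ f≡0 = begin
  ℕΣ.sum f                             ≡⟨ ℕΣ.sum-remove {i = i₀} f ⟩
  f i₀ + ℕΣ.sum (removeAt f i₀)        ≡⟨ cong (f i₀ +_) (ℕΣ.sum-cong-≗ λ j → f≡0 _ (punchInᵢ≢i i₀ j)) ⟩
  f i₀ + ℕΣ.sum {n} (λ _ → 0)          ≡⟨ cong (f i₀ +_) (trans (sum-const n 0) (ℕ.*-zeroʳ n)) ⟩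
  f i₀ + 0                             ≡⟨ ℕ.+-identityʳ (f i₀) ⟩
  f i₀                                 ∎
  where open ≡-Reasoning

module Summation {c : Level} (F : FiniteField c) where
  open FiniteField F using (Carrier; size; enum)
  open Inverse enum using (to; from; strictlyInverseˡ; strictlyInverseʳ)

  sumOverF≡sum : (g : Carrier → ℕ) → sumOverF F g ≡ ℕΣ.sum (g ∘ to)
  sumOverF≡sum g = trans (worker size to refl) (go≡sum size to)
    where
    -- The where-bound worker of sumOverF cannot be named; go is a meta that
    -- worker solves to it by unification once size and to are generalised.
    go : (s : ℕ) → (Fin s → Carrier) → ℕ
    go = _
    worker : ∀ s e → _≡_ {A = ∃ λ s → Fin s → Carrier} (size , to) (s , e) → sumOverF F g ≡ go s e
    worker s e eq with size | to | eq
    ... | .s | .e | refl = refl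
    go≡sum : ∀ s e → go s e ≡ ℕΣ.sum (g ∘ e)
    go≡sum zero    e = refl
    go≡sum (suc s) e = cong (g (e zero) +_) (go≡sum s (e ∘ suc))

  sumOverF-cong : ∀ {f g : Carrier → ℕ} → f ≗ g → sumOverF F f ≡ sumOverF F g
  sumOverF-cong {f} {g} f≗g =
    trans (sumOverF≡sum f) (trans (ℕΣ.sum-cong-≗ (f≗g ∘ to)) (sym (sumOverF≡sum g)))

  sumOverF-const : ∀ k → sumOverF F (λ _ → k) ≡ size * k
  sumOverF-const k = trans (sumOverF≡sum _) (sum-const size k)

  *-distribˡ-sumOverF : ∀ k (f : Carrier → ℕ) → k * sumOverF F f ≡ sumOverF F (λ t → k * f t)
  *-distribˡ-sumOverF k f = begin
    k * sumOverF F f             ≡⟨ cong (k *_) (sumOverF≡sum f) ⟩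
    k * ℕΣ.sum (f ∘ to)          ≡⟨ ℕΣ.*-distribˡ-sum k (f ∘ to) ⟩
    ℕΣ.sum (λ i → k * f (to i))  ≡⟨ sumOverF≡sum _ ⟨
    sumOverF F (λ t → k * f t)   ∎
    where open ≡-Reasoning

  sumOverF-comm : (h : Carrier → Carrier → ℕ) →
    sumOverF F (λ s → sumOverF F (h s)) ≡ sumOverF F (λ t → sumOverF F (λ s → h s t))
  sumOverF-comm h = begin
    sumOverF F (λ s → sumOverF F (h s))                   ≡⟨ unfold h ⟩
    ℕΣ.sum (λ i → ℕΣ.sum (λ j → h (to i) (to j)))         ≡⟨ ℕΣ.∑-comm (λ i j → h (to i) (to j)) ⟩
    ℕΣ.sum (λ j → ℕΣ.sum (λ i → h (to i) (to j)))         ≡⟨ unfold (λ t s → h s t) ⟨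
    sumOverF F (λ t → sumOverF F (λ s → h s t))           ∎
    where
    open ≡-Reasoning
    unfold : ∀ h → sumOverF F (λ s → sumOverF F (h s)) ≡ ℕΣ.sum (λ i → ℕΣ.sum (λ j → h (to i) (to j)))
    unfold h = trans (sumOverF≡sum _) (ℕΣ.sum-cong-≗ (λ i → sumOverF≡sum (h (to i))))

  sumOverF-single : (f : Carrier → ℕ) (t₀ : Carrier) → (∀ t → t ≢ t₀ → f t ≡ 0) → sumOverF F f ≡ f t₀
  sumOverF-single f t₀ f≡0 = begin
    sumOverF F f       ≡⟨ sumOverF≡sum f ⟩
    ℕΣ.sum (f ∘ to)    ≡⟨ sum-single (f ∘ to) (from t₀) (λ i i≢ → f≡0 (to i) (i≢ ∘ to≡⇒≡from)) ⟩
    f (to (from t₀))   ≡⟨ cong f (strictlyInverseˡ t₀) ⟩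
    f t₀               ∎
    where
    open ≡-Reasoning
    to≡⇒≡from : ∀ {i} → to i ≡ t₀ → i ≡ from t₀
    to≡⇒≡from eq = trans (sym (strictlyInverseʳ _)) (cong from eq)

  sumVec-cong : ∀ N {f g : Vector Carrier N → ℕ} → (∀ x → f x ≡ g x) → sumVec F N f ≡ sumVec F N g
  sumVec-cong zero    f≗g = f≗g _
  sumVec-cong (suc N) f≗g = sumOverF-cong λ s → sumVec-cong N (λ x → f≗g (s ∷ x))

  *-distribˡ-sumVec : ∀ N k (f : Vector Carrier N → ℕ) → k * sumVec F N f ≡ sumVec F N (λ x → k * f x)
  *-distribˡ-sumVec zero    k f = refl
  *-distribˡ-sumVec (suc N) k f =
    trans (*-distribˡ-sumOverF k _) (sumOverF-cong λ s → *-distribˡ-sumVec N k (λ x → f (s ∷ x)))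

  sumOverF-sumVec-comm : ∀ N (h : Carrier → Vector Carrier N → ℕ) →
    sumOverF F (λ t → sumVec F N (h t)) ≡ sumVec F N (λ y → sumOverF F (λ t → h t y))
  sumOverF-sumVec-comm zero    h = refl
  sumOverF-sumVec-comm (suc N) h =
    trans (sumOverF-comm _) (sumOverF-cong λ s → sumOverF-sumVec-comm N (λ t x → h t (s ∷ x)))

  sumVec-insert : ∀ N (p : Fin (suc N)) (g : Vector Carrier (suc N) → ℕ) →
    sumVec F (suc N) g ≡ sumVec F N (λ y → sumOverF F (λ t → g (insert p t y)))
  sumVec-insert N       zero    g = sumOverF-sumVec-comm N (λ t y → g (t ∷ y))
  sumVec-insert (suc N) (suc p) g = sumOverF-cong λ s → sumVec-insert N p (λ x → g (s ∷ x))

module FieldAlgebra {c : Level} (F : FiniteField c) where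
  open FiniteField F using (Carrier; 0#; 1#; _≟_; isCommutativeRing; inverse)
  open Summation F using (sumOverF-single)

  ring : CommutativeRing c c
  ring = record { isCommutativeRing = isCommutativeRing }

  open CommutativeRing ring
    using (+-identityˡ; +-identityʳ; +-comm; zeroˡ; *-assoc; *-comm; *-identityˡ; -‿inverseʳ; +-abelianGroup)
    renaming (_+_ to _⊕_; _*_ to _⊛_; -_ to ⊝_)
  module FΣ = SemiringSum (CommutativeRing.semiring ring)
  open AbelianGroupProperties +-abelianGroup using (inverseʳ-unique)

  iverson-cong : ∀ {ℓ₁ ℓ₂} {A : Set ℓ₁} {B : Set ℓ₂} → A ⇔ B → (a? : Dec A) (b? : Dec B) →
                 iverson F a? ≡ iverson F b?
  iverson-cong _   (yes _) (yes _) = refl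
  iverson-cong A⇔B (yes a) (no ¬b) = contradiction (Equivalence.to A⇔B a) ¬b
  iverson-cong A⇔B (no ¬a) (yes b) = contradiction (Equivalence.from A⇔B b) ¬a
  iverson-cong _   (no _)  (no _)  = refl

  iverson-× : ∀ {ℓ₁ ℓ₂ ℓ₃} {P : Set ℓ₁} {A : Set ℓ₂} {B : Set ℓ₃} → P ⇔ (A × B) →
              (p? : Dec P) (a? : Dec A) (b? : Dec B) → iverson F p? ≡ iverson F a? * iverson F b?
  iverson-× P⇔A×B p? (yes a) (yes b) = iverson-cong P⇔A×B p? (yes (a , b))
  iverson-× P⇔A×B p? (yes _) (no ¬b) = iverson-cong P⇔A×B p? (no (¬b ∘ proj₂))
  iverson-× P⇔A×B p? (no ¬a) _       = iverson-cong P⇔A×B p? (no (¬a ∘ proj₁))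

  affine-root : ∀ α β → α ≢ 0# → ∃ λ t₀ → α ⊛ t₀ ⊕ β ≡ 0# × (∀ t → α ⊛ t ⊕ β ≡ 0# → t ≡ t₀)
  affine-root α β α≢0 with inverse α α≢0
  ... | α⁻¹ , αα⁻¹≡1 = α⁻¹ ⊛ ⊝ β , root , unique
    where
    open ≡-Reasoning
    cancel : ∀ u → α ⊛ (α⁻¹ ⊛ u) ≡ u
    cancel u = trans (sym (*-assoc α α⁻¹ u)) (trans (cong (_⊛ u) αα⁻¹≡1) (*-identityˡ u))
    root : α ⊛ (α⁻¹ ⊛ ⊝ β) ⊕ β ≡ 0#
    root = trans (cong (_⊕ β) (cancel (⊝ β))) (trans (+-comm _ β) (-‿inverseʳ β))
    unique : ∀ t → α ⊛ t ⊕ β ≡ 0# → t ≡ α⁻¹ ⊛ ⊝ β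
    unique t αt+β≡0 = begin
      t                 ≡⟨ cancel t ⟨
      α ⊛ (α⁻¹ ⊛ t)     ≡⟨ cong (α ⊛_) (*-comm α⁻¹ t) ⟩
      α ⊛ (t ⊛ α⁻¹)     ≡⟨ *-assoc α t α⁻¹ ⟨
      α ⊛ t ⊛ α⁻¹       ≡⟨ cong (_⊛ α⁻¹) (inverseʳ-unique β (α ⊛ t) (trans (+-comm β _) αt+β≡0)) ⟩
      ⊝ β ⊛ α⁻¹         ≡⟨ *-comm (⊝ β) α⁻¹ ⟩
      α⁻¹ ⊛ ⊝ β         ∎

  sumOverF-affine-root : ∀ α β → α ≢ 0# → sumOverF F (λ t → iverson F ((α ⊛ t ⊕ β) ≟ 0#)) ≡ 1
  sumOverF-affine-root α β α≢0 with affine-root α β α≢0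
  ... | t₀ , root , unique = trans (sumOverF-single _ t₀ not-root) (is-root ((α ⊛ t₀ ⊕ β) ≟ 0#))
    where
    not-root : ∀ t → t ≢ t₀ → iverson F ((α ⊛ t ⊕ β) ≟ 0#) ≡ 0
    not-root t t≢t₀ with (α ⊛ t ⊕ β) ≟ 0#
    ... | yes αt+β≡0 = contradiction (unique t αt+β≡0) t≢t₀
    ... | no _       = refl
    is-root : (d : Dec (α ⊛ t₀ ⊕ β ≡ 0#)) → iverson F d ≡ 1
    is-root (yes _)  = refl
    is-root (no ¬r)  = contradiction root ¬r

  sumF≡sum : ∀ r (f : Vector Carrier r) → sumF F r f ≡ FΣ.sum f
  sumF≡sum zero    f = refl
  sumF≡sum (suc r) f = cong (f zero ⊕_) (sumF≡sum r (f ∘ suc))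

  sum-update : ∀ {r} (f g : Vector Carrier r) (i₀ : Fin r) →
               (∀ i → i ≢ i₀ → f i ≡ g i) → g i₀ ≡ 0# → FΣ.sum f ≡ f i₀ ⊕ FΣ.sum g
  sum-update {suc r} f g i₀ f≡g gi₀≡0 = begin
    FΣ.sum f                              ≡⟨ FΣ.sum-remove {i = i₀} f ⟩
    f i₀ ⊕ FΣ.sum (removeAt f i₀)         ≡⟨ cong (f i₀ ⊕_) (FΣ.sum-cong-≗ λ j → f≡g _ (punchInᵢ≢i i₀ j)) ⟩
    f i₀ ⊕ FΣ.sum (removeAt g i₀)         ≡⟨ cong (f i₀ ⊕_) (+-identityˡ _) ⟨
    f i₀ ⊕ (0# ⊕ FΣ.sum (removeAt g i₀))  ≡⟨ cong (λ z → f i₀ ⊕ (z ⊕ FΣ.sum (removeAt g i₀))) gi₀≡0 ⟨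
    f i₀ ⊕ (g i₀ ⊕ FΣ.sum (removeAt g i₀)) ≡⟨ cong (f i₀ ⊕_) (FΣ.sum-remove {i = i₀} g) ⟨
    f i₀ ⊕ FΣ.sum g                       ∎
    where open ≡-Reasoning

  *-congˡ-when-≢0 : ∀ u {a b} → (u ≢ 0# → a ≡ b) → u ⊛ a ≡ u ⊛ b
  *-congˡ-when-≢0 u a≡b with u ≟ 0#
  ... | yes refl = trans (zeroˡ _) (sym (zeroˡ _))
  ... | no u≢0   = cong (u ⊛_) (a≡b u≢0)

  sumF-cong : ∀ r {f g : Vector Carrier r} → f ≗ g → sumF F r f ≡ sumF F r g
  sumF-cong r {f} {g} f≗g = trans (sumF≡sum r f) (trans (FΣ.sum-cong-≗ f≗g) (sym (sumF≡sum r g)))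

  hankelAt : ∀ {r c L} → r + c ≤ suc L → Fin r → Fin c → Fin L
  hankelAt h i j = fromℕ< (hankelIdx F h i j)

  toℕ-hankelAt : ∀ {r c L} (h : r + c ≤ suc L) (i : Fin r) (j : Fin c) →
                 toℕ (hankelAt h i j) ≡ toℕ i + toℕ j
  toℕ-hankelAt h i j = toℕ-fromℕ< (hankelIdx F h i j)

  rowHankel-cong : ∀ {L} r c (h : r + c ≤ suc L) (w : Vector Carrier r)
                   (x x' : Vector Carrier L) (j : Fin c) →
    (∀ i → w i ≢ 0# → x (hankelAt h i j) ≡ x' (hankelAt h i j)) →
    rowHankel F r c h w x j ≡ rowHankel F r c h w x' j
  rowHankel-cong r c h w x x' j x≡x' = sumF-cong r λ i → *-congˡ-when-≢0 (w i) (x≡x' i)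

  rowHankel-init : ∀ {L} r c c' (h : suc r + c ≤ suc L) (h' : r + c' ≤ suc L)
                   (w : Vector Carrier (suc r)) →
    w (fromℕ r) ≡ 0# → (x : Vector Carrier L) (j : Fin c) (j' : Fin c') → toℕ j ≡ toℕ j' →
    rowHankel F (suc r) c h w x j ≡ rowHankel F r c' h' (w ∘ inject₁) x j'
  rowHankel-init r c c' h h' w wr≡0 x j j' j≡j' = begin
    rowHankel F (suc r) c h w x j           ≡⟨ sumF≡sum (suc r) f ⟩
    FΣ.sum f                                ≡⟨ FΣ.sum-init-last f ⟩
    FΣ.sum (f ∘ inject₁) ⊕ f (fromℕ r)      ≡⟨ cong (FΣ.sum (f ∘ inject₁) ⊕_) (trans (cong (_⊛ _) wr≡0) (zeroˡ _)) ⟩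
    FΣ.sum (f ∘ inject₁) ⊕ 0#               ≡⟨ +-identityʳ _ ⟩
    FΣ.sum (f ∘ inject₁)                    ≡⟨ sumF≡sum r (f ∘ inject₁) ⟨
    sumF F r (f ∘ inject₁)                  ≡⟨ sumF-cong r (λ i → cong (λ ι → w (inject₁ i) ⊛ x ι) (same-entry i)) ⟩
    rowHankel F r c' h' (w ∘ inject₁) x j'  ∎
    where
    open ≡-Reasoning
    f : Vector Carrier (suc r)
    f i = w i ⊛ x (hankelAt h i j)
    same-entry : ∀ i → hankelAt h (inject₁ i) j ≡ hankelAt h' i j'
    same-entry i = toℕ-injective (begin
      toℕ (hankelAt h (inject₁ i) j)  ≡⟨ toℕ-hankelAt h (inject₁ i) j ⟩
      toℕ (inject₁ i) + toℕ j         ≡⟨ cong₂ _+_ (toℕ-inject₁ i) j≡j' ⟩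
      toℕ i + toℕ j'                  ≡⟨ toℕ-hankelAt h' i j' ⟨
      toℕ (hankelAt h' i j')          ∎)

module HankelFibres {c : Level} (F : FiniteField c) (k m n : ℕ) (hk : k ≤ suc n)
    (v : Vector (FiniteField.Carrier F) (suc m)) (v-last≡0 : v (fromℕ m) ≡ FiniteField.0# F)
    (a : Vector (FiniteField.Carrier F) k)
    (d : Fin (suc m)) (vd≢0 : v d ≢ FiniteField.0# F)
    (d-largest : ∀ i → v i ≢ FiniteField.0# F → i Fin.≤ d) where
  open FiniteField F using (Carrier; 0#; _≟_; size)
  open FieldAlgebra F
  open CommutativeRing ring using (zeroʳ) renaming (_+_ to _⊕_; _*_ to _⊛_)
  open Summation F using (sumOverF-cong; sumOverF-const; *-distribˡ-sumOverF)

  vH : Vector Carrier (suc (m + n)) → Vector Carrier (suc n)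
  vH = rowHankel F (suc m) (suc n) (bound₁ F m n) v

  RvH : Vector Carrier (suc (m + n)) → Vector Carrier (suc (suc n))
  RvH = rowHankel F m (suc (suc n)) (bound₂ F m n) (v ∘ inject₁)

  prefix lhs rhs : Vector Carrier (suc (m + n)) → ℕ
  prefix x = iverson F (prefix? F k (suc (m + n)) (prefixBound F k m n hk) x a)
  lhs x = prefix x * iverson F (isZero? F (suc n) (vH x))
  rhs x = prefix x * iverson F (isZero? F (suc (suc n)) (RvH x))

  d<m : toℕ d ℕ.< m
  d<m = ℕ.≤∧≢⇒< (ℕ.s≤s⁻¹ (toℕ<n d)) λ d≡m →
    vd≢0 (trans (cong v (toℕ-injective (trans d≡m (sym (toℕ-fromℕ m))))) v-last≡0)

  p<1+m+n : toℕ d + suc n ℕ.< suc (m + n)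
  p<1+m+n = subst (toℕ d + suc n ℕ.<_) (ℕ.+-suc m n) (ℕ.+-mono-<-≤ d<m ℕ.≤-refl)

  p : Fin (suc (m + n))
  p = fromℕ< p<1+m+n

  toℕ-p : toℕ p ≡ toℕ d + suc n
  toℕ-p = toℕ-fromℕ< p<1+m+n

  insert-below-p : ∀ (t t' : Carrier) (y : Vector Carrier (m + n)) {j} →
                   toℕ j ℕ.< toℕ p → insert p t y j ≡ insert p t' y j
  insert-below-p t t' y j<p = insert-≢ t t' y λ p≡j → ℕ.<⇒≢ j<p (cong toℕ (sym p≡j))

  prefix-fibre : ∀ (t t' : Carrier) y → prefix (insert p t y) ≡ prefix (insert p t' y)
  prefix-fibre t t' y = iverson-cong (∀≡-cong a (λ i → insert-below-p t t' y (i<p i))) _ _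
    where
    i<p : ∀ i → toℕ (Fin.inject≤ i (prefixBound F k m n hk)) ℕ.< toℕ p
    i<p i = begin-strict
      toℕ (Fin.inject≤ i _) ≡⟨ toℕ-inject≤ i _ ⟩
      toℕ i                 <⟨ toℕ<n i ⟩
      k                     ≤⟨ hk ⟩
      suc n                 ≤⟨ ℕ.m≤n+m (suc n) (toℕ d) ⟩
      toℕ d + suc n         ≡⟨ toℕ-p ⟨
      toℕ p                 ∎
      where open ℕ.≤-Reasoning

  hankelAt<p : ∀ {r c} (h : r + c ≤ suc (suc (m + n))) (i : Fin r) (j : Fin c) →
               toℕ i + toℕ j ℕ.< toℕ d + suc n → toℕ (hankelAt h i j) ℕ.< toℕ p
  hankelAt<p h i j i+j<p = subst₂ ℕ._<_ (sym (toℕ-hankelAt h i j)) (sym toℕ-p) i+j<p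

  vH-fibre : ∀ (t t' : Carrier) y → vH (insert p t y) ≗ vH (insert p t' y)
  vH-fibre t t' y j =
    rowHankel-cong (suc m) (suc n) (bound₁ F m n) v (insert p t y) (insert p t' y) j λ i vi≢0 →
    insert-below-p t t' y (hankelAt<p (bound₁ F m n) i j (ℕ.+-mono-≤-< (d-largest i vi≢0) (toℕ<n j)))

  last : Fin (suc (suc n))
  last = fromℕ (suc n)

  RvH≡0⇔ : ∀ x → (∀ j → RvH x j ≡ 0#) ⇔ ((∀ j → vH x j ≡ 0#) × RvH x last ≡ 0#)
  RvH≡0⇔ x = mk⇔ (λ RvH≡0 → (λ j → trans (vH≡RvH j (sym (toℕ-inject₁ j))) (RvH≡0 _)) , RvH≡0 last) from
    where
    vH≡RvH : ∀ j {j'} → toℕ j ≡ toℕ j' → vH x j ≡ RvH x j'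
    vH≡RvH j {j'} = rowHankel-init m (suc n) (suc (suc n)) (bound₁ F m n) (bound₂ F m n) v v-last≡0 x j j'
    from : (∀ j → vH x j ≡ 0#) × RvH x last ≡ 0# → ∀ j → RvH x j ≡ 0#
    from (vH≡0 , RvH-last≡0) j with toℕ j ℕ.≟ suc n
    ... | yes j≡1+n =
      subst (λ j → RvH x j ≡ 0#) (toℕ-injective (trans (toℕ-fromℕ (suc n)) (sym j≡1+n))) RvH-last≡0
    ... | no  j≢1+n = trans (sym (vH≡RvH _ (toℕ-lower₁ j (j≢1+n ∘ sym)))) (vH≡0 _)

  RvH-last : ∀ (t : Carrier) y → RvH (insert p t y) last ≡ v d ⊛ t ⊕ RvH (insert p 0# y) last
  RvH-last t y = begin
    RvH (insert p t y) last        ≡⟨ sumF≡sum m (f t) ⟩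
    FΣ.sum (f t)                   ≡⟨ sum-update (f t) (f 0#) d′ f≡f0 (trans (f-d′ 0#) (zeroʳ (v d))) ⟩
    f t d′ ⊕ FΣ.sum (f 0#)         ≡⟨ cong₂ _⊕_ (f-d′ t) (sym (sumF≡sum m (f 0#))) ⟩
    v d ⊛ t ⊕ RvH (insert p 0# y) last ∎
    where
    open ≡-Reasoning
    f : Carrier → Vector Carrier m
    f s i = v (inject₁ i) ⊛ insert p s y (hankelAt (bound₂ F m n) i last)
    d′ : Fin m
    d′ = fromℕ< d<m
    toℕ-d′ : toℕ d′ ≡ toℕ d
    toℕ-d′ = toℕ-fromℕ< d<m
    f-d′ : ∀ s → f s d′ ≡ v d ⊛ s
    f-d′ s = cong₂ _⊛_ (cong v (toℕ-injective (trans (toℕ-inject₁ d′) toℕ-d′)))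
      (trans (cong (insert p s y) (toℕ-injective (begin
        toℕ (hankelAt (bound₂ F m n) d′ last) ≡⟨ toℕ-hankelAt (bound₂ F m n) d′ last ⟩
        toℕ d′ + toℕ last                    ≡⟨ cong₂ _+_ toℕ-d′ (toℕ-fromℕ (suc n)) ⟩
        toℕ d + suc n                        ≡⟨ toℕ-p ⟨
        toℕ p                                ∎))) (insert-lookup p s y))
    f≡f0 : ∀ i → i ≢ d′ → f t i ≡ f 0# i
    f≡f0 i i≢d′ = *-congˡ-when-≢0 (v (inject₁ i)) λ vi≢0 → insert-below-p t 0# y
      (hankelAt<p (bound₂ F m n) i last (ℕ.+-mono-<-≤ (i<d vi≢0) (ℕ.≤-reflexive (toℕ-fromℕ (suc n)))))
      where
      i<d : v (inject₁ i) ≢ 0# → toℕ i ℕ.< toℕ d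
      i<d vi≢0 = ℕ.≤∧≢⇒< (subst (ℕ._≤ toℕ d) (toℕ-inject₁ i) (d-largest (inject₁ i) vi≢0))
                          (λ i≡d → i≢d′ (toℕ-injective (trans i≡d (sym toℕ-d′))))

  lhs-fibre : ∀ (t : Carrier) y → lhs (insert p t y) ≡ lhs (insert p 0# y)
  lhs-fibre t y = cong₂ _*_ (prefix-fibre t 0# y) (iverson-cong (∀≡-cong (λ _ → 0#) (vH-fibre t 0# y)) _ _)

  rhs-fibre : ∀ (t : Carrier) y → rhs (insert p t y) ≡
              lhs (insert p 0# y) * iverson F ((v d ⊛ t ⊕ RvH (insert p 0# y) last) ≟ 0#)
  rhs-fibre t y = begin
    prefix x * iverson F (isZero? F (suc (suc n)) (RvH x))
      ≡⟨ cong (prefix x *_) (iverson-× (RvH≡0⇔ x) _ (isZero? F (suc n) (vH x)) (RvH x last ≟ 0#)) ⟩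
    prefix x * (iverson F (isZero? F (suc n) (vH x)) * iverson F (RvH x last ≟ 0#))
      ≡⟨ ℕ.*-assoc (prefix x) _ _ ⟨
    lhs x * iverson F (RvH x last ≟ 0#)
      ≡⟨ cong₂ _*_ (lhs-fibre t y) (iverson-cong (mk⇔ (trans (sym (RvH-last t y))) (trans (RvH-last t y))) _ _) ⟩
    lhs (insert p 0# y) * iverson F ((v d ⊛ t ⊕ RvH (insert p 0# y) last) ≟ 0#) ∎
    where
    open ≡-Reasoning
    x = insert p t y

  sumOverF-lhs-fibre : ∀ y → sumOverF F (λ t → lhs (insert p t y)) ≡ size * lhs (insert p 0# y)
  sumOverF-lhs-fibre y = trans (sumOverF-cong λ t → lhs-fibre t y) (sumOverF-const _)

  sumOverF-rhs-fibre : ∀ y → sumOverF F (λ t → rhs (insert p t y)) ≡ lhs (insert p 0# y)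
  sumOverF-rhs-fibre y = begin
    sumOverF F (λ t → rhs (insert p t y))         ≡⟨ sumOverF-cong (λ t → rhs-fibre t y) ⟩
    sumOverF F (λ t → L₀ * I t)                   ≡⟨ *-distribˡ-sumOverF L₀ I ⟨
    L₀ * sumOverF F I                             ≡⟨ cong (L₀ *_) (sumOverF-affine-root (v d) _ vd≢0) ⟩
    L₀ * 1                                        ≡⟨ ℕ.*-identityʳ L₀ ⟩
    L₀                                            ∎
    where
    open ≡-Reasoning
    L₀ = lhs (insert p 0# y)
    I : Carrier → ℕ
    I t = iverson F ((v d ⊛ t ⊕ RvH (insert p 0# y) last) ≟ 0#)

lemma3p5 : {c : Level} (F : FiniteField c) (k m n : ℕ) (hk : k ≤ suc n)
           (v : Fin (suc m) → FiniteField.Carrier F) →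
           ¬ (∀ i → v i ≡ FiniteField.0# F) →
           v (fromℕ m) ≡ FiniteField.0# F →
           (a : Fin k → FiniteField.Carrier F) →
           sumVec F (suc (m + n)) (λ x →
               iverson F (prefix? F k (suc (m + n)) (prefixBound F k m n hk) x a)
             * iverson F (isZero? F (suc n) (rowHankel F (suc m) (suc n) (bound₁ F m n) v x)))
           ≡ FiniteField.size F *
             sumVec F (suc (m + n)) (λ x →
               iverson F (prefix? F k (suc (m + n)) (prefixBound F k m n hk) x a)
             * iverson F (isZero? F (suc (suc n))
                 (rowHankel F m (suc (suc n)) (bound₂ F m n) (λ i → v (inject₁ i)) x)))
lemma3p5 F k m n hk v v≢0 v-last≡0 a with ∀⊎∃¬-largest (λ i → v i ≟ 0#)
  where open FiniteField F using (_≟_; 0#)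
... | inj₁ v≡0 = contradiction v≡0 v≢0
... | inj₂ (d , vd≢0 , d-largest) = begin
    sumVec F (suc (m + n)) lhs
      ≡⟨ sumVec-insert (m + n) p lhs ⟩
    sumVec F (m + n) (λ y → sumOverF F (λ t → lhs (insert p t y)))
      ≡⟨ sumVec-cong (m + n) sumOverF-lhs-fibre ⟩
    sumVec F (m + n) (λ y → size * lhs (insert p 0# y))
      ≡⟨ *-distribˡ-sumVec (m + n) size _ ⟨
    size * sumVec F (m + n) (λ y → lhs (insert p 0# y))
      ≡⟨ cong (size *_) (sumVec-cong (m + n) sumOverF-rhs-fibre) ⟨
    size * sumVec F (m + n) (λ y → sumOverF F (λ t → rhs (insert p t y)))
      ≡⟨ cong (size *_) (sumVec-insert (m + n) p rhs) ⟨
    size * sumVec F (suc (m + n)) rhs ∎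
  where
  open ≡-Reasoning
  open FiniteField F using (0#; size)
  open Summation F using (sumVec-insert; sumVec-cong; *-distribˡ-sumVec)
  open HankelFibres F k m n hk v v-last≡0 a d vd≢0 d-largest
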